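{- Let $k\ge 4$ and let $G_k$, $G_{k+1}$ be the graphs defined below (for $\ell=2$). Define $\psi(0)=0$, $\psi(IV_b^k)=IV_b^{k+1}$, and $\psi(m)=m+3\cdot 2^{k-2}$ for $III_b^k\le m\le II_t^k$. Then $\psi$ is a color-preserving graph isomorphism from the induced subgraph of $G_k$ on $\{0, IV_b^k\}\cup\{III_b^k,\ldots,II_t^k\}$ (i.e. $B_2\cup B_3\cup\{IV_b^k\}$ of $G_k$) onto the induced subgraph of $G_{k+1}$ on $\{0, IV_b^{k+1}\}\cup\{II_b^{k+1},\ldots,II_t^{k+1}\}$ (i.e. $B_2\cup\{IV_b^{k+1}\}$ of $G_{k+1}$).
   Context: The pruning function $\operatorname{P}_{2}:\mathbb{Z}_{>0}\to\mathbb{Z}_{\geq 0}$: write $m$ in binary, padded on the left with zeros as needed, let $z$ be the position (position $0$ = least significant bit) of the second zero bit counted from the right, let $q = 2^{z}\lfloor m/2^{z}\rfloor$, and set $\operatorname{P}_2(m)=\max(q-1,0)$. For an integer $k\ge 2$, $G_k$ is the directed graph with node set $\{0\}\cup\{2^{k-1}-1,\ldots,2^k-1\}$ and edges: for each $m$ with $2^{k-1}-1\le m<2^k-1$, a "blue" edge from $m$ to $m+1$ (weight $-1$) and a "red" edge from $\operatorname{P}_2(m)$ to $m$ (weight $+1$). For $k\ge 4$ set $I_t^k=2^k-1$, $I_b^k=2^k-2^{k-2}-1$, $II_t^k=2^k-2^{k-2}-2$, $II_b^k=2^k-2^{k-2}-2^{k-4}-1$, $III_t^k=2^k-2^{k-2}-2^{k-4}-2$,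 $III_b^k=2^k-2^{k-2}-2^{k-3}-1$, $IV_t^k=2^k-2^{k-2}-2^{k-3}-2$, $IV_b^k=2^{k-1}-1$. For $X\in\{I,II,III,IV\}$, the box $B_j$ ($j=1,2,3,4$ respectively) of $G_k$ is the induced subgraph of $G_k$ on $\{0\}\cup\{X_b^k,\ldots,X_t^k\}$. -}

module Defs where

open import Data.Nat using (ℕ; zero; suc; _+_; _*_; _∸_; _^_; _≤_; _<_; _≟_; NonZero)
open import Data.Nat.DivMod using (_/_; _%_)
open import Data.Nat.Properties using (m^n≢0)
open import Data.Product using (_×_; Σ; _,_)
open import Data.Sum using (_⊎_)
open import Relation.Nullary using (yes; no)
open import Relation.Binary.PropositionalEquality using (_≡_)
open import Function.Bundles using (_⇔_)

-- zeroPos fuel c m : position (0 = least significant bit) of the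
-- (c+1)-th zero bit of m counted from the right (binary expansion of m
-- padded on the left with infinitely many zeros).  The 'fuel' argument
-- only ensures structural termination; fuel m + 2 is always enough
-- (the second zero bit sits at position ≤ ⌊log₂ m⌋ + 2 ≤ m + 1).
zeroPos : ℕ → ℕ → ℕ → ℕ
zeroPos zero    c       m = 0
zeroPos (suc f) c       m with m % 2
zeroPos (suc f) zero    m | zero  = 0
zeroPos (suc f) (suc c) m | zero  = suc (zeroPos f c (m / 2))
zeroPos (suc f) c       m | suc _ = suc (zeroPos f c (m / 2))

secondZero : ℕ → ℕ
secondZero m = zeroPos (m + 2) 1 m

-- P₂(m) = max(2^z ⌊m / 2^z⌋ − 1, 0)  (truncated subtraction = max(·,0))
P₂ : ℕ → ℕ
P₂ m = (2 ^ z * (_/_ m (2 ^ z) {{m^n≢0 2 z}})) ∸ 1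
  where z = secondZero m

Node : ℕ → ℕ → Set
Node k v = v ≡ 0 ⊎ (2 ^ (k ∸ 1) ∸ 1 ≤ v × v ≤ 2 ^ k ∸ 1)

Blue : ℕ → ℕ → ℕ → Set
Blue k u v = (2 ^ (k ∸ 1) ∸ 1 ≤ u × u < 2 ^ k ∸ 1) × v ≡ suc u

Red : ℕ → ℕ → ℕ → Set
Red k u v = (2 ^ (k ∸ 1) ∸ 1 ≤ v × v < 2 ^ k ∸ 1) × u ≡ P₂ v

IIt IIb IIIb IVb : ℕ → ℕ
IIt  k = 2 ^ k ∸ 2 ^ (k ∸ 2) ∸ 2
IIb  k = 2 ^ k ∸ 2 ^ (k ∸ 2) ∸ 2 ^ (k ∸ 4) ∸ 1
IIIb k = 2 ^ k ∸ 2 ^ (k ∸ 2) ∸ 2 ^ (k ∸ 3) ∸ 1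
IVb  k = 2 ^ (k ∸ 1) ∸ 1

Dom : ℕ → ℕ → Set
Dom k v = v ≡ 0 ⊎ v ≡ IVb k ⊎ (IIIb k ≤ v × v ≤ IIt k)

Cod : ℕ → ℕ → Set
Cod k v = v ≡ 0 ⊎ v ≡ IVb (suc k) ⊎ (IIb (suc k) ≤ v × v ≤ IIt (suc k))

-- the map ψ (its values outside Dom k are irrelevant)
ψ : ℕ → ℕ → ℕ
ψ k m with m ≟ 0
... | yes _ = 0
... | no _ with m ≟ IVb k
...   | yes _ = IVb (suc k)
...   | no _  = m + 3 * 2 ^ (k ∸ 2)

-- Induced subgraph of (Node, Blue, Red) on a vertex set S ⊆ Node:
-- vertices S, blue/red edges those of the big graph with both ends in S.
record IsColourIso
  (S : ℕ → Set) (B R : ℕ → ℕ → Set)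
  (T : ℕ → Set) (B' R' : ℕ → ℕ → Set)
  (f : ℕ → ℕ) : Set where
  field
    maps      : ∀ u → S u → T (f u)
    injective : ∀ u v → S u → S v → f u ≡ f v → u ≡ v
    surjective : ∀ w → T w → Σ ℕ (λ u → S u × f u ≡ w)
    blue      : ∀ u v → S u → S v → B u v ⇔ B' (f u) (f v)
    red       : ∀ u v → S u → S v → R u v ⇔ R' (f u) (f v)

-- Write v ∈ [III_b^k, II_t^k] as r + 2^(k-3)·t with r < 2^(k-3): either r = 2^(k-3) − 1 and
-- t = 4, or t = 5.  Adding the shift 3·2^(k-2) = 2^(k-3)·6 leaves r alone and turns t into 10
-- resp. 11.  If r has two zero bits, P₂ only clears bits of r and so commutes with the shift;
-- otherwise the second zero is found in t (4 = 100₂, 5 = 101₂ resp. 10 = 1010₂, 11 = 1011₂),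
-- giving P₂(v) = 2^(k-1) − 1 = IV_b^k and P₂(v + shift) = 2^k − 1 = IV_b^(k+1).  Numbers 2^j − 1
-- have P₂ = 0.  A map that fixes 0, sends the point IV_b^k to IV_b^(k+1), translates an interval
-- and commutes with P₂ in this way is a colour-preserving isomorphism of the induced subgraphs.
module Submission where

open import Data.Bool.Base using (T)
open import Data.Empty using (⊥-elim)
open import Data.List using (_∷_; [])
open import Data.Nat
open import Data.Nat.DivMod
open import Data.Nat.Divisibility using (divides-refl)
open import Data.Nat.Properties
open import Data.Nat.Tactic.RingSolver using (solve)
open import Data.Product using (Σ; _×_; _,_; proj₁; proj₂)
open import Data.Sum using (_⊎_; inj₁; inj₂)
open import Function.Bundles using (_⇔_; mk⇔; Equivalence)
import Function.Properties.Equivalence as ⇔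
open import Relation.Nullary using (yes; no; contradiction)
open import Relation.Binary.PropositionalEquality
open import Defs

open Equivalence using (to; from)

-- Clearing the bits below a zero

clearBelowZero : ℕ → ℕ → ℕ → ℕ
clearBelowZero zero    c       m = m
clearBelowZero (suc f) c       m with m % 2
clearBelowZero (suc f) zero    m | zero  = m
clearBelowZero (suc f) (suc c) m | zero  = 2 * clearBelowZero f c (m / 2)
clearBelowZero (suc f) c       m | suc _ = 2 * clearBelowZero f c (m / 2)

clearLowBits : ℕ → ℕ → ℕ
clearLowBits z m = 2 ^ z * (_/_ m (2 ^ z) {{m^n≢0 2 z}})

clearLowBits-0 : ∀ m → clearLowBits 0 m ≡ m
clearLowBits-0 m = trans (*-identityˡ (m / 1)) (n/1≡n m)

clearLowBits-suc : ∀ z m → clearLowBits (suc z) m ≡ 2 * clearLowBits z (m / 2)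
clearLowBits-suc z m = trans (*-assoc 2 (2 ^ z) _) (cong (λ q → 2 * (2 ^ z * q))
  (sym (m/n/o≡m/[n*o] m 2 (2 ^ z) {{_}} {{m^n≢0 2 z}} {{m^n≢0 2 (suc z)}})))

clearLowBits-zeroPos : ∀ f c m → clearLowBits (zeroPos f c m) m ≡ clearBelowZero f c m
clearLowBits-zeroPos zero    c m = clearLowBits-0 m
clearLowBits-zeroPos (suc f) c m with m % 2
clearLowBits-zeroPos (suc f) zero    m | zero  = clearLowBits-0 m
clearLowBits-zeroPos (suc f) (suc c) m | zero  =
  trans (clearLowBits-suc (zeroPos f c (m / 2)) m) (cong (2 *_) (clearLowBits-zeroPos f c (m / 2)))
clearLowBits-zeroPos (suc f) c       m | suc _ =
  trans (clearLowBits-suc (zeroPos f c (m / 2)) m) (cong (2 *_) (clearLowBits-zeroPos f c (m / 2)))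

clearBelowZero-even-zero : ∀ f m → m % 2 ≡ 0 → clearBelowZero (suc f) 0 m ≡ m
clearBelowZero-even-zero f m even with m % 2
... | zero = refl

clearBelowZero-even-suc : ∀ f c m → m % 2 ≡ 0 →
  clearBelowZero (suc f) (suc c) m ≡ 2 * clearBelowZero f c (m / 2)
clearBelowZero-even-suc f c m even with m % 2
... | zero = refl

clearBelowZero-odd : ∀ f c m → m % 2 ≡ 1 →
  clearBelowZero (suc f) c m ≡ 2 * clearBelowZero f c (m / 2)
clearBelowZero-odd f zero    m odd with m % 2
... | suc _ = refl
clearBelowZero-odd f (suc c) m odd with m % 2
... | suc _ = refl

clearBelowZero-0 : ∀ f c → clearBelowZero f c 0 ≡ 0
clearBelowZero-0 zero    c       = refl
clearBelowZero-0 (suc f) zero    = refl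
clearBelowZero-0 (suc f) (suc c) = cong (2 *_) (clearBelowZero-0 f c)

m<2^[1+p]⇒m/2<2^p : ∀ m p → m < 2 ^ suc p → m / 2 < 2 ^ p
m<2^[1+p]⇒m/2<2^p m p m<2^[1+p] = m<n*o⇒m/o<n (subst (m <_) (*-comm 2 (2 ^ p)) m<2^[1+p])

clearBelowZero-moreFuel : ∀ f g c m → m < 2 ^ f → clearBelowZero (f + g) c m ≡ clearBelowZero f c m
clearBelowZero-moreFuel zero    g c zero    _ = clearBelowZero-0 g c
clearBelowZero-moreFuel zero    g c (suc m) (s≤s ())
clearBelowZero-moreFuel (suc f) g c m m<2^f with m % 2
clearBelowZero-moreFuel (suc f) g zero    m m<2^f | zero  = refl
clearBelowZero-moreFuel (suc f) g (suc c) m m<2^f | zero  =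
  cong (2 *_) (clearBelowZero-moreFuel f g c (m / 2) (m<2^[1+p]⇒m/2<2^p m f m<2^f))
clearBelowZero-moreFuel (suc f) g c       m m<2^f | suc _ =
  cong (2 *_) (clearBelowZero-moreFuel f g c (m / 2) (m<2^[1+p]⇒m/2<2^p m f m<2^f))

clearBelowZero-fuelIrrelevant : ∀ f f' c m → m < 2 ^ f → m < 2 ^ f' →
  clearBelowZero f c m ≡ clearBelowZero f' c m
clearBelowZero-fuelIrrelevant f f' c m m<2^f m<2^f' = begin
  clearBelowZero f c m         ≡⟨ clearBelowZero-moreFuel f f' c m m<2^f ⟨
  clearBelowZero (f + f') c m  ≡⟨ cong (λ F → clearBelowZero F c m) (+-comm f f') ⟩
  clearBelowZero (f' + f) c m  ≡⟨ clearBelowZero-moreFuel f' f c m m<2^f' ⟩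
  clearBelowZero f' c m        ∎
  where open ≡-Reasoning

n<2^n : ∀ n → n < 2 ^ n
n<2^n zero    = s≤s z≤n
n<2^n (suc n) = subst (suc n <_) (cong (2 ^ n +_) (sym (+-identityʳ (2 ^ n))))
  (+-mono-≤-< (m^n>0 2 n) (n<2^n n))

P₂≡clearBelowZero∸1 : ∀ f m → m < 2 ^ f → P₂ m ≡ clearBelowZero f 1 m ∸ 1
P₂≡clearBelowZero∸1 f m m<2^f = cong (_∸ 1)
  (trans (clearLowBits-zeroPos (m + 2) 1 m)
         (clearBelowZero-fuelIrrelevant (m + 2) f 1 m m<2^[m+2] m<2^f))
  where
  m<2^[m+2] : m < 2 ^ (m + 2)
  m<2^[m+2] = <-≤-trans (n<2^n m) (^-monoʳ-≤ 2 (m≤m+n m 2))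

%2≡0⊎%2≡1 : ∀ r → r % 2 ≡ 0 ⊎ r % 2 ≡ 1
%2≡0⊎%2≡1 r with r % 2 | m%n<n r 2
... | zero        | _ = inj₁ refl
... | suc zero    | _ = inj₂ refl
... | suc (suc _) | s≤s (s≤s ())

[r+2y]%2≡r%2 : ∀ r y → (r + 2 * y) % 2 ≡ r % 2
[r+2y]%2≡r%2 r y = trans (cong (λ z → (r + z) % 2) (*-comm 2 y)) ([m+kn]%n≡m%n r y 2)

[r+2y]/2≡r/2+y : ∀ r y → (r + 2 * y) / 2 ≡ r / 2 + y
[r+2y]/2≡r/2+y r y = trans (cong (λ z → (r + z) / 2) (*-comm 2 y))
  (trans (+-distrib-/-∣ʳ r (divides-refl y)) (cong (r / 2 +_) (m*n/n≡m y 2)))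

2*[r/2]≤r : ∀ r → 2 * (r / 2) ≤ r
2*[r/2]≤r r = subst (_≤ r) (*-comm (r / 2) 2) (m/n*n≤m r 2)

r≡r%2+2*[r/2] : ∀ r → r ≡ r % 2 + 2 * (r / 2)
r≡r%2+2*[r/2] r = trans (m≡m%n+[m/n]*n r 2) (cong (r % 2 +_) (*-comm (r / 2) 2))

2^[1+p]*t≡2*[2^p*t] : ∀ p t → 2 ^ suc p * t ≡ 2 * (2 ^ p * t)
2^[1+p]*t≡2*[2^p*t] p t = *-assoc 2 (2 ^ p) t

[r+2^[1+p]*t]%2≡r%2 : ∀ r p t → (r + 2 ^ suc p * t) % 2 ≡ r % 2
[r+2^[1+p]*t]%2≡r%2 r p t =
  trans (cong (λ y → (r + y) % 2) (2^[1+p]*t≡2*[2^p*t] p t)) ([r+2y]%2≡r%2 r (2 ^ p * t))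

[r+2^[1+p]*t]/2≡r/2+2^p*t : ∀ r p t → (r + 2 ^ suc p * t) / 2 ≡ r / 2 + 2 ^ p * t
[r+2^[1+p]*t]/2≡r/2+2^p*t r p t =
  trans (cong (λ y → (r + y) / 2) (2^[1+p]*t≡2*[2^p*t] p t)) ([r+2y]/2≡r/2+y r (2 ^ p * t))

zerosBelow : ℕ → ℕ → ℕ
zerosBelow zero    r = 0
zerosBelow (suc p) r with r % 2
... | zero  = suc (zerosBelow p (r / 2))
... | suc _ = zerosBelow p (r / 2)

zerosBelow-even : ∀ p r → r % 2 ≡ 0 → zerosBelow (suc p) r ≡ suc (zerosBelow p (r / 2))
zerosBelow-even p r even with r % 2
... | zero = refl

zerosBelow-odd : ∀ p r → r % 2 ≡ 1 → zerosBelow (suc p) r ≡ zerosBelow p (r / 2)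
zerosBelow-odd p r odd with r % 2
... | suc _ = refl

allOnes : ℕ → ℕ
allOnes zero    = 0
allOnes (suc p) = 1 + 2 * allOnes p

suc-allOnes : ∀ p → suc (allOnes p) ≡ 2 ^ p
suc-allOnes zero    = refl
suc-allOnes (suc p) = trans (sym (*-suc 2 (allOnes p))) (cong (2 *_) (suc-allOnes p))

zerosBelow-allOnes : ∀ p → zerosBelow p (allOnes p) ≡ 0
zerosBelow-allOnes zero    = refl
zerosBelow-allOnes (suc p) = begin
  zerosBelow (suc p) (1 + 2 * allOnes p)
    ≡⟨ zerosBelow-odd p (1 + 2 * allOnes p) ([r+2y]%2≡r%2 1 (allOnes p)) ⟩
  zerosBelow p ((1 + 2 * allOnes p) / 2)
    ≡⟨ cong (zerosBelow p) ([r+2y]/2≡r/2+y 1 (allOnes p)) ⟩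
  zerosBelow p (allOnes p)
    ≡⟨ zerosBelow-allOnes p ⟩
  0 ∎
  where open ≡-Reasoning

zerosBelow≡0⇒allOnes : ∀ p r → r < 2 ^ p → zerosBelow p r ≡ 0 → r ≡ allOnes p
zerosBelow≡0⇒allOnes zero    zero    _        _  = refl
zerosBelow≡0⇒allOnes zero    (suc r) (s≤s ()) _
zerosBelow≡0⇒allOnes (suc p) r       r<2^p    z≡0 with %2≡0⊎%2≡1 r
... | inj₁ even = contradiction (trans (sym (zerosBelow-even p r even)) z≡0) λ ()
... | inj₂ odd  = begin
  r                      ≡⟨ r≡r%2+2*[r/2] r ⟩
  r % 2 + 2 * (r / 2)    ≡⟨ cong₂ (λ b h → b + 2 * h) odd r/2≡allOnes ⟩
  1 + 2 * allOnes p      ∎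
  where
  open ≡-Reasoning
  r/2≡allOnes : r / 2 ≡ allOnes p
  r/2≡allOnes = zerosBelow≡0⇒allOnes p (r / 2) (m<2^[1+p]⇒m/2<2^p r p r<2^p)
                  (trans (sym (zerosBelow-odd p r odd)) z≡0)

clearBelowZero-step : ∀ F p r t d →
  clearBelowZero (suc F) (zerosBelow (suc p) r + d) (r + 2 ^ suc p * t) ≡
  2 * clearBelowZero F (zerosBelow p (r / 2) + d) (r / 2 + 2 ^ p * t)
clearBelowZero-step F p r t d = trans unfold
  (cong (λ y → 2 * clearBelowZero F (zerosBelow p (r / 2) + d) y) ([r+2^[1+p]*t]/2≡r/2+2^p*t r p t))
  where
  m = r + 2 ^ suc p * t
  unfold : clearBelowZero (suc F) (zerosBelow (suc p) r + d) m ≡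
           2 * clearBelowZero F (zerosBelow p (r / 2) + d) (m / 2)
  unfold with %2≡0⊎%2≡1 r
  ... | inj₁ even = trans (cong (λ c → clearBelowZero (suc F) (c + d) m) (zerosBelow-even p r even))
    (clearBelowZero-even-suc F (zerosBelow p (r / 2) + d) m (trans ([r+2^[1+p]*t]%2≡r%2 r p t) even))
  ... | inj₂ odd  = trans (cong (λ c → clearBelowZero (suc F) (c + d) m) (zerosBelow-odd p r odd))
    (clearBelowZero-odd F (zerosBelow p (r / 2) + d) m (trans ([r+2^[1+p]*t]%2≡r%2 r p t) odd))

clearBelowZero-above : ∀ p g d r t → r < 2 ^ p →
  clearBelowZero (p + g) (zerosBelow p r + d) (r + 2 ^ p * t) ≡ 2 ^ p * clearBelowZero g d t
clearBelowZero-above zero    g d zero    t _ =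
  trans (cong (clearBelowZero g d) (*-identityˡ t)) (sym (*-identityˡ _))
clearBelowZero-above zero    g d (suc r) t (s≤s ())
clearBelowZero-above (suc p) g d r       t r<2^p = begin
  clearBelowZero (suc (p + g)) (zerosBelow (suc p) r + d) (r + 2 ^ suc p * t)
    ≡⟨ clearBelowZero-step (p + g) p r t d ⟩
  2 * clearBelowZero (p + g) (zerosBelow p (r / 2) + d) (r / 2 + 2 ^ p * t)
    ≡⟨ cong (2 *_) (clearBelowZero-above p g d (r / 2) t (m<2^[1+p]⇒m/2<2^p r p r<2^p)) ⟩
  2 * (2 ^ p * clearBelowZero g d t)
    ≡⟨ *-assoc 2 (2 ^ p) _ ⟨
  2 ^ suc p * clearBelowZero g d t ∎
  where open ≡-Reasoning

-- The (c+1)-th zero of r + 2^p·t lies among the p lowest bits, so the clearing never sees t.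
ClearedWithin : ℕ → ℕ → ℕ → Set
ClearedWithin p c r =
  Σ ℕ λ x → x ≤ r × ∀ g t → clearBelowZero (p + g) c (r + 2 ^ p * t) ≡ x + 2 ^ p * t

clearedWithin-step : ∀ p c c' r →
  (∀ F t → clearBelowZero (suc F) c (r + 2 ^ suc p * t) ≡
           2 * clearBelowZero F c' ((r + 2 ^ suc p * t) / 2)) →
  ClearedWithin p c' (r / 2) → ClearedWithin (suc p) c r
clearedWithin-step p c c' r unfold (x , x≤r/2 , clears) =
  2 * x , ≤-trans (*-monoʳ-≤ 2 x≤r/2) (2*[r/2]≤r r) , λ g t → begin
    clearBelowZero (suc (p + g)) c (r + 2 ^ suc p * t)
      ≡⟨ unfold (p + g) t ⟩
    2 * clearBelowZero (p + g) c' ((r + 2 ^ suc p * t) / 2)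
      ≡⟨ cong (λ y → 2 * clearBelowZero (p + g) c' y) ([r+2^[1+p]*t]/2≡r/2+2^p*t r p t) ⟩
    2 * clearBelowZero (p + g) c' (r / 2 + 2 ^ p * t)
      ≡⟨ cong (2 *_) (clears g t) ⟩
    2 * (x + 2 ^ p * t)
      ≡⟨ *-distribˡ-+ 2 x _ ⟩
    2 * x + 2 * (2 ^ p * t)
      ≡⟨ cong (2 * x +_) (2^[1+p]*t≡2*[2^p*t] p t) ⟨
    2 * x + 2 ^ suc p * t ∎
  where open ≡-Reasoning

clearBelowZero-within : ∀ p c r → r < 2 ^ p → c < zerosBelow p r → ClearedWithin p c r
clearBelowZero-within (suc p) c r r<2^p c<z with %2≡0⊎%2≡1 r | c
... | inj₁ even | zero   = r , ≤-refl , λ g t →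
  clearBelowZero-even-zero (p + g) (r + 2 ^ suc p * t) (trans ([r+2^[1+p]*t]%2≡r%2 r p t) even)
... | inj₁ even | suc c' = clearedWithin-step p (suc c') c' r
  (λ F t → clearBelowZero-even-suc F c' (r + 2 ^ suc p * t) (trans ([r+2^[1+p]*t]%2≡r%2 r p t) even))
  (clearBelowZero-within p c' (r / 2) (m<2^[1+p]⇒m/2<2^p r p r<2^p)
    (s≤s⁻¹ (subst (suc c' <_) (zerosBelow-even p r even) c<z)))
... | inj₂ odd  | c      = clearedWithin-step p c c r
  (λ F t → clearBelowZero-odd F c (r + 2 ^ suc p * t) (trans ([r+2^[1+p]*t]%2≡r%2 r p t) odd))
  (clearBelowZero-within p c (r / 2) (m<2^[1+p]⇒m/2<2^p r p r<2^p) (subst (c <_) (zerosBelow-odd p r odd) c<z))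

r+2^p*t<2^[p+g] : ∀ p g {r t} → r < 2 ^ p → t < 2 ^ g → r + 2 ^ p * t < 2 ^ (p + g)
r+2^p*t<2^[p+g] p g {r} {t} r<2^p t<2^g = begin-strict
  r + 2 ^ p * t    <⟨ +-monoˡ-< (2 ^ p * t) r<2^p ⟩
  2 ^ p + 2 ^ p * t ≡⟨ *-suc (2 ^ p) t ⟨
  2 ^ p * suc t    ≤⟨ *-monoʳ-≤ (2 ^ p) t<2^g ⟩
  2 ^ p * 2 ^ g    ≡⟨ ^-distribˡ-+-* 2 p g ⟨
  2 ^ (p + g)      ∎
  where open ≤-Reasoning

P₂-secondZeroAbove : ∀ p g d r t → r < 2 ^ p → t < 2 ^ g → zerosBelow p r + d ≡ 1 →
  P₂ (r + 2 ^ p * t) ≡ 2 ^ p * clearBelowZero g d t ∸ 1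
P₂-secondZeroAbove p g d r t r<2^p t<2^g z+d≡1 = begin
  P₂ (r + 2 ^ p * t)
    ≡⟨ P₂≡clearBelowZero∸1 (p + g) _ (r+2^p*t<2^[p+g] p g r<2^p t<2^g) ⟩
  clearBelowZero (p + g) 1 (r + 2 ^ p * t) ∸ 1
    ≡⟨ cong (λ c → clearBelowZero (p + g) c (r + 2 ^ p * t) ∸ 1) z+d≡1 ⟨
  clearBelowZero (p + g) (zerosBelow p r + d) (r + 2 ^ p * t) ∸ 1
    ≡⟨ cong (_∸ 1) (clearBelowZero-above p g d r t r<2^p) ⟩
  2 ^ p * clearBelowZero g d t ∸ 1 ∎
  where open ≡-Reasoning

P₂-secondZeroWithin : ∀ p r → r < 2 ^ p → 1 < zerosBelow p r →
  Σ ℕ λ x → x ≤ r × ∀ t → P₂ (r + 2 ^ p * t) ≡ x + 2 ^ p * t ∸ 1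
P₂-secondZeroWithin p r r<2^p 1<z with clearBelowZero-within p 1 r r<2^p 1<z
... | x , x≤r , clears = x , x≤r , λ t →
  trans (P₂≡clearBelowZero∸1 (p + t) _ (r+2^p*t<2^[p+g] p t r<2^p (n<2^n t))) (cong (_∸ 1) (clears t t))

P₂[2^p∸1]≡0 : ∀ p → P₂ (2 ^ p ∸ 1) ≡ 0
P₂[2^p∸1]≡0 p = begin
  P₂ (2 ^ p ∸ 1)                       ≡⟨ cong P₂ 2^p∸1≡allOnes+2^p*0 ⟩
  P₂ (allOnes p + 2 ^ p * 0)           ≡⟨ P₂-secondZeroAbove p 0 1 (allOnes p) 0 allOnes<2^p (s≤s z≤n)
                                            (cong (_+ 1) (zerosBelow-allOnes p)) ⟩
  2 ^ p * 0 ∸ 1                        ≡⟨ cong (_∸ 1) (*-zeroʳ (2 ^ p)) ⟩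
  0                                    ∎
  where
  open ≡-Reasoning
  allOnes<2^p : allOnes p < 2 ^ p
  allOnes<2^p = ≤-reflexive (suc-allOnes p)
  2^p∸1≡allOnes+2^p*0 : 2 ^ p ∸ 1 ≡ allOnes p + 2 ^ p * 0
  2^p∸1≡allOnes+2^p*0 = trans (cong (_∸ 1) (sym (suc-allOnes p)))
    (sym (trans (cong (allOnes p +_) (*-zeroʳ (2 ^ p))) (+-identityʳ (allOnes p))))

-- Pointed boxes and interval shifts

Pointed : ℕ → ℕ → ℕ → ℕ → Set
Pointed A L H v = v ≡ 0 ⊎ v ≡ A ⊎ (L ≤ v × v ≤ H)

BlueEdge : ℕ → ℕ → ℕ → ℕ → Set
BlueEdge lo hi u v = (lo ≤ u × u < hi) × v ≡ suc u

RedEdge : (ℕ → ℕ) → ℕ → ℕ → ℕ → ℕ → Set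
RedEdge P lo hi u v = (lo ≤ v × v < hi) × u ≡ P v

-- Pointed A L H sits in a graph with node set {0} ∪ [A, A'].
record IsPointedBox (A L H A' : ℕ) : Set where
  field
    0<A   : 0 < A
    A<A'  : A < A'
    1+A<L : suc A < L
    H<A'  : H < A'

  L≤⇒A< : ∀ {v} → L ≤ v → A < v
  L≤⇒A< L≤v = <-≤-trans (<-trans (n<1+n A) 1+A<L) L≤v

  L≤⇒≢0 : ∀ {v} → L ≤ v → v ≢ 0
  L≤⇒≢0 L≤v refl = contradiction (L≤⇒A< L≤v) λ ()

  L≤⇒≢A : ∀ {v} → L ≤ v → v ≢ A
  L≤⇒≢A L≤v refl = <-irrefl refl (L≤⇒A< L≤v)

  pointed⇒node : ∀ {v} → Pointed A L H v → v ≡ 0 ⊎ (A ≤ v × v ≤ A')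
  pointed⇒node (inj₁ v≡0)              = inj₁ v≡0
  pointed⇒node (inj₂ (inj₁ refl))      = inj₂ (≤-refl , <⇒≤ A<A')
  pointed⇒node (inj₂ (inj₂ (L≤v , v≤H))) = inj₂ (<⇒≤ (L≤⇒A< L≤v) , <⇒≤ (≤-<-trans v≤H H<A'))

  inRange⇔positive : ∀ {v} → Pointed A L H v → (A ≤ v × v < A') ⇔ 0 < v
  inRange⇔positive {v} pv = mk⇔ (λ (A≤v , _) → <-≤-trans 0<A A≤v) (fromPositive pv)
    where
    fromPositive : Pointed A L H v → 0 < v → A ≤ v × v < A'
    fromPositive (inj₁ refl)                 ()
    fromPositive (inj₂ (inj₁ refl))          _ = ≤-refl , A<A'
    fromPositive (inj₂ (inj₂ (L≤v , v≤H))) _ = <⇒≤ (L≤⇒A< L≤v) , ≤-<-trans v≤H H<A'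

  redEdge⇔ : ∀ P {u v} → Pointed A L H v → RedEdge P A A' u v ⇔ (0 < v × u ≡ P v)
  redEdge⇔ P pv = mk⇔ (λ (inRange , u≡Pv) → to (inRange⇔positive pv) inRange , u≡Pv)
                      (λ (0<v , u≡Pv) → from (inRange⇔positive pv) 0<v , u≡Pv)

  blueEdge⇔ : ∀ {u v} → Pointed A L H u → Pointed A L H v →
    BlueEdge A A' u v ⇔ ((L ≤ u × u ≤ H) × v ≡ suc u)
  blueEdge⇔ {u} {v} pu pv = mk⇔ (toInterval pu pv)
    (λ ((L≤u , u≤H) , v≡1+u) → (<⇒≤ (L≤⇒A< L≤u) , ≤-<-trans u≤H H<A') , v≡1+u)
    where
    toInterval : Pointed A L H u → Pointed A L H v → BlueEdge A A' u v → (L ≤ u × u ≤ H) × v ≡ suc u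
    toInterval (inj₁ refl)          _  ((A≤0 , _) , _) = contradiction A≤0 (<⇒≱ 0<A)
    toInterval (inj₂ (inj₁ refl))   (inj₁ refl) (_ , ())
    toInterval (inj₂ (inj₁ refl))   (inj₂ (inj₁ refl)) (_ , A≡1+A) = contradiction (sym A≡1+A) 1+n≢n
    toInterval (inj₂ (inj₁ refl))   (inj₂ (inj₂ (L≤v , _))) (_ , refl) = contradiction 1+A<L (<⇒≱ (s≤s L≤v))
    toInterval (inj₂ (inj₂ u∈I))    _  (_ , v≡1+u) = u∈I , v≡1+u

record IntervalShift (A A' A'' L H L' H' s : ℕ) (f P : ℕ → ℕ) : Set where
  field
    dom      : IsPointedBox A L H A'
    cod      : IsPointedBox A' L' H' A''
    L'≡L+s   : L' ≡ L + s
    H'≡H+s   : H' ≡ H + s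
    f-0      : f 0 ≡ 0
    f-A      : f A ≡ A'
    f-shift  : ∀ {x} → L ≤ x → x ≤ H → f x ≡ x + s
    P-A      : P A ≡ 0
    P-A'     : P A' ≡ 0
    P-shift  : ∀ {v} → L ≤ v → v ≤ H → Pointed A L H (P v) × P (v + s) ≡ f (P v)

  private
    module Dom = IsPointedBox dom
    module Cod = IsPointedBox cod

  f-interval : ∀ {x} → L ≤ x → x ≤ H → L' ≤ f x × f x ≤ H'
  f-interval {x} L≤x x≤H rewrite f-shift L≤x x≤H | L'≡L+s | H'≡H+s =
    +-monoˡ-≤ s L≤x , +-monoˡ-≤ s x≤H

  f-maps : ∀ {u} → Pointed A L H u → Pointed A' L' H' (f u)
  f-maps (inj₁ refl)               = inj₁ f-0
  f-maps (inj₂ (inj₁ refl))        = inj₂ (inj₁ f-A)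
  f-maps (inj₂ (inj₂ (L≤u , u≤H))) = inj₂ (inj₂ (f-interval L≤u u≤H))

  f-injective : ∀ {u v} → Pointed A L H u → Pointed A L H v → f u ≡ f v → u ≡ v
  f-injective (inj₁ refl)        (inj₁ refl)        _ = refl
  f-injective (inj₂ (inj₁ refl)) (inj₂ (inj₁ refl)) _ = refl
  f-injective (inj₁ refl)        (inj₂ (inj₁ refl)) eq =
    contradiction (trans (sym f-0) (trans eq f-A)) (<⇒≢ Cod.0<A)
  f-injective (inj₂ (inj₁ refl)) (inj₁ refl)        eq =
    contradiction (trans (sym f-0) (trans (sym eq) f-A)) (<⇒≢ Cod.0<A)
  f-injective (inj₁ refl)        (inj₂ (inj₂ (L≤v , v≤H))) eq =
    ⊥-elim (Cod.L≤⇒≢0 (proj₁ (f-interval L≤v v≤H)) (trans (sym eq) f-0))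
  f-injective (inj₂ (inj₁ refl)) (inj₂ (inj₂ (L≤v , v≤H))) eq =
    ⊥-elim (Cod.L≤⇒≢A (proj₁ (f-interval L≤v v≤H)) (trans (sym eq) f-A))
  f-injective (inj₂ (inj₂ (L≤u , u≤H))) (inj₁ refl)        eq =
    ⊥-elim (Cod.L≤⇒≢0 (proj₁ (f-interval L≤u u≤H)) (trans eq f-0))
  f-injective (inj₂ (inj₂ (L≤u , u≤H))) (inj₂ (inj₁ refl)) eq =
    ⊥-elim (Cod.L≤⇒≢A (proj₁ (f-interval L≤u u≤H)) (trans eq f-A))
  f-injective (inj₂ (inj₂ (L≤u , u≤H))) (inj₂ (inj₂ (L≤v , v≤H))) eq =
    +-cancelʳ-≡ s _ _ (trans (sym (f-shift L≤u u≤H)) (trans eq (f-shift L≤v v≤H)))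

  f-surjective : ∀ w → Pointed A' L' H' w → Σ ℕ λ u → Pointed A L H u × f u ≡ w
  f-surjective w (inj₁ refl)                  = 0 , inj₁ refl , f-0
  f-surjective w (inj₂ (inj₁ refl))           = A , inj₂ (inj₁ refl) , f-A
  f-surjective w (inj₂ (inj₂ (L'≤w , w≤H'))) =
    w ∸ s , inj₂ (inj₂ (L≤w∸s , w∸s≤H)) , trans (f-shift L≤w∸s w∸s≤H) (m∸n+n≡m (≤-trans (m≤n+m s L) L+s≤w))
    where
    L+s≤w : L + s ≤ w
    L+s≤w = subst (_≤ w) L'≡L+s L'≤w
    L≤w∸s : L ≤ w ∸ s
    L≤w∸s = m+n≤o⇒m≤o∸n L L+s≤w
    w∸s≤H : w ∸ s ≤ H
    w∸s≤H = m≤n+o⇒m∸n≤o w s (subst (w ≤_) (trans H'≡H+s (+-comm H s)) w≤H')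

  image-in-interval : ∀ {u} → Pointed A L H u → L' ≤ f u → L ≤ u × u ≤ H
  image-in-interval (inj₁ refl)        L'≤f0 = ⊥-elim (Cod.L≤⇒≢0 L'≤f0 f-0)
  image-in-interval (inj₂ (inj₁ refl)) L'≤fA = ⊥-elim (Cod.L≤⇒≢A L'≤fA f-A)
  image-in-interval (inj₂ (inj₂ u∈I))  _     = u∈I

  f-suc⇔ : ∀ {u v} → L ≤ u → u ≤ H → Pointed A L H v → v ≡ suc u ⇔ f v ≡ suc (f u)
  f-suc⇔ {u} L≤u u≤H (inj₁ refl) = mk⇔ (λ ()) (λ f0≡1+fu → contradiction (trans (sym f-0) f0≡1+fu) 0≢1+n)
  f-suc⇔ {u} L≤u u≤H (inj₂ (inj₁ refl)) = mk⇔
    (λ A≡1+u → contradiction A≡1+u (<⇒≢ (<-trans (Dom.L≤⇒A< L≤u) (n<1+n u))))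
    (λ fA≡1+fu → contradiction (trans (sym f-A) fA≡1+fu)
      (<⇒≢ (<-trans (Cod.L≤⇒A< (proj₁ (f-interval L≤u u≤H))) (n<1+n (f u)))))
  f-suc⇔ {u} L≤u u≤H (inj₂ (inj₂ (L≤v , v≤H)))
    rewrite f-shift L≤u u≤H | f-shift L≤v v≤H = mk⇔ (cong (_+ s)) (+-cancelʳ-≡ s _ (suc u))

  f-positive⇔ : ∀ {u} → Pointed A L H u → 0 < u ⇔ 0 < f u
  f-positive⇔ pu = mk⇔
    (λ 0<u → n≢0⇒n>0 λ fu≡0 → <⇒≢ 0<u (sym (f-injective pu (inj₁ refl) (trans fu≡0 (sym f-0)))))
    (λ 0<fu → n≢0⇒n>0 λ { refl → <⇒≢ 0<fu (sym f-0) })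

  P∘f≡f∘P : ∀ {v} → Pointed A L H v → 0 < v → Pointed A L H (P v) × P (f v) ≡ f (P v)
  P∘f≡f∘P (inj₁ refl) ()
  P∘f≡f∘P (inj₂ (inj₁ refl)) _ = subst (Pointed A L H) (sym P-A) (inj₁ refl) , (begin
    P (f A)  ≡⟨ cong P f-A ⟩
    P A'     ≡⟨ P-A' ⟩
    0        ≡⟨ f-0 ⟨
    f 0      ≡⟨ cong f P-A ⟨
    f (P A)  ∎)
    where open ≡-Reasoning
  P∘f≡f∘P (inj₂ (inj₂ (L≤v , v≤H))) _ =
    proj₁ (P-shift L≤v v≤H) , trans (cong P (f-shift L≤v v≤H)) (proj₂ (P-shift L≤v v≤H))

  blue⇔ : ∀ u v → Pointed A L H u → Pointed A L H v →
    BlueEdge A A' u v ⇔ BlueEdge A' A'' (f u) (f v)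
  blue⇔ u v pu pv =
    ⇔.trans (Dom.blueEdge⇔ pu pv) (⇔.trans shifted (⇔.sym (Cod.blueEdge⇔ (f-maps pu) (f-maps pv))))
    where
    shifted : ((L ≤ u × u ≤ H) × v ≡ suc u) ⇔ ((L' ≤ f u × f u ≤ H') × f v ≡ suc (f u))
    shifted = mk⇔
      (λ ((L≤u , u≤H) , v≡1+u) → f-interval L≤u u≤H , to (f-suc⇔ L≤u u≤H pv) v≡1+u)
      (λ ((L'≤fu , _) , fv≡1+fu) → let (L≤u , u≤H) = image-in-interval pu L'≤fu in
        (L≤u , u≤H) , from (f-suc⇔ L≤u u≤H pv) fv≡1+fu)

  red⇔ : ∀ u v → Pointed A L H u → Pointed A L H v →
    RedEdge P A A' u v ⇔ RedEdge P A' A'' (f u) (f v)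
  red⇔ u v pu pv =
    ⇔.trans (Dom.redEdge⇔ P pv) (⇔.trans shifted (⇔.sym (Cod.redEdge⇔ P (f-maps pv))))
    where
    shifted : (0 < v × u ≡ P v) ⇔ (0 < f v × f u ≡ P (f v))
    shifted = mk⇔
      (λ (0<v , u≡Pv) → to (f-positive⇔ pv) 0<v , trans (cong f u≡Pv) (sym (proj₂ (P∘f≡f∘P pv 0<v))))
      (λ (0<fv , fu≡Pfv) → let 0<v = from (f-positive⇔ pv) 0<fv in
        0<v , f-injective pu (proj₁ (P∘f≡f∘P pv 0<v)) (trans fu≡Pfv (proj₂ (P∘f≡f∘P pv 0<v))))

  isColourIso : IsColourIso (Pointed A L H) (BlueEdge A A') (RedEdge P A A')
                            (Pointed A' L' H') (BlueEdge A' A'') (RedEdge P A' A'') f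
  isColourIso = record
    { maps       = λ _ → f-maps
    ; injective  = λ _ _ → f-injective
    ; surjective = f-surjective
    ; blue       = blue⇔
    ; red        = red⇔
    }

-- The boxes of G_k and G_(k+1)

ψ-IVb : ∀ k → IVb k ≢ 0 → ψ k (IVb k) ≡ IVb (suc k)
ψ-IVb k IVb≢0 with IVb k ≟ 0
... | yes IVb≡0 = contradiction IVb≡0 IVb≢0
... | no _ with IVb k ≟ IVb k
...   | yes _ = refl
...   | no IVb≢IVb = contradiction refl IVb≢IVb

ψ-shift : ∀ k m → m ≢ 0 → m ≢ IVb k → ψ k m ≡ m + 3 * 2 ^ (k ∸ 2)
ψ-shift k m m≢0 m≢IVb with m ≟ 0
... | yes m≡0 = contradiction m≡0 m≢0
... | no _ with m ≟ IVb k
...   | yes m≡IVb = contradiction m≡IVb m≢IVb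
...   | no _ = refl

m+n≡o⇒o∸m≡n : ∀ o m n → m + n ≡ o → o ∸ m ≡ n
m+n≡o⇒o∸m≡n o m n refl = m+n∸m≡n m n

IsPointedBox-≡ : ∀ {A L H A' B M K B'} → A ≡ B → L ≡ M → H ≡ K → A' ≡ B' →
  IsPointedBox B M K B' → IsPointedBox A L H A'
IsPointedBox-≡ refl refl refl refl box = box

-- k = n + 4 and a = 2^n − 1: every box boundary becomes affine in a, free of truncated subtraction.
module Boxes (n a : ℕ) (2^n≡1+a : 2 ^ n ≡ suc a) where

  k : ℕ
  k = 4 + n

  2^[j+n] : ∀ j → 2 ^ (j + n) ≡ 2 ^ j + 2 ^ j * a
  2^[j+n] j = begin
    2 ^ (j + n)    ≡⟨ ^-distribˡ-+-* 2 j n ⟩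
    2 ^ j * 2 ^ n  ≡⟨ cong (2 ^ j *_) 2^n≡1+a ⟩
    2 ^ j * suc a  ≡⟨ *-suc (2 ^ j) a ⟩
    2 ^ j + 2 ^ j * a ∎
    where open ≡-Reasoning

  IVb-k : IVb k ≡ 7 + 8 * a
  IVb-k = cong (_∸ 1) (2^[j+n] 3)

  IVb-1+k : IVb (1 + k) ≡ 15 + 16 * a
  IVb-1+k = cong (_∸ 1) (2^[j+n] 4)

  IVb-2+k : IVb (2 + k) ≡ 31 + 32 * a
  IVb-2+k = cong (_∸ 1) (2^[j+n] 5)

  2^k∸2^[k∸2] : 2 ^ k ∸ 2 ^ (k ∸ 2) ≡ 12 + 12 * a
  2^k∸2^[k∸2] = trans (cong₂ _∸_ (2^[j+n] 4) (2^[j+n] 2))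
    (m+n≡o⇒o∸m≡n (16 + 16 * a) (4 + 4 * a) (12 + 12 * a) (solve (a ∷ [])))

  2^[1+k]∸2^[k∸1] : 2 ^ (1 + k) ∸ 2 ^ (k ∸ 1) ≡ 24 + 24 * a
  2^[1+k]∸2^[k∸1] = trans (cong₂ _∸_ (2^[j+n] 5) (2^[j+n] 3))
    (m+n≡o⇒o∸m≡n (32 + 32 * a) (8 + 8 * a) (24 + 24 * a) (solve (a ∷ [])))

  IIIb-k : IIIb k ≡ 9 + 10 * a
  IIIb-k = cong (_∸ 1) (trans (cong₂ _∸_ 2^k∸2^[k∸2] (2^[j+n] 1))
    (m+n≡o⇒o∸m≡n (12 + 12 * a) (2 + 2 * a) (10 + 10 * a) (solve (a ∷ []))))

  IIt-k : IIt k ≡ 10 + 12 * a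
  IIt-k = cong (_∸ 2) 2^k∸2^[k∸2]

  IIb-1+k : IIb (1 + k) ≡ 21 + 22 * a
  IIb-1+k = cong (_∸ 1) (trans (cong₂ _∸_ 2^[1+k]∸2^[k∸1] (2^[j+n] 1))
    (m+n≡o⇒o∸m≡n (24 + 24 * a) (2 + 2 * a) (22 + 22 * a) (solve (a ∷ []))))

  IIt-1+k : IIt (1 + k) ≡ 22 + 24 * a
  IIt-1+k = cong (_∸ 2) 2^[1+k]∸2^[k∸1]

  shift≡ : 3 * 2 ^ (k ∸ 2) ≡ 12 + 12 * a
  shift≡ = trans (cong (3 *_) (2^[j+n] 2)) (solve (a ∷ []))

  affine-≤ : ∀ c d e f → T (c ≤ᵇ d) → T (e ≤ᵇ f) → c + e * a ≤ d + f * a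
  affine-≤ c d e f c≤d e≤f = +-mono-≤ (≤ᵇ⇒≤ c d c≤d) (*-monoˡ-≤ a (≤ᵇ⇒≤ e f e≤f))

  dom : IsPointedBox (IVb k) (IIIb k) (IIt k) (IVb (1 + k))
  dom = IsPointedBox-≡ IVb-k IIIb-k IIt-k IVb-1+k record
    { 0<A   = s≤s z≤n
    ; A<A'  = affine-≤ 8 15 8 16 _ _
    ; 1+A<L = affine-≤ 9 9 8 10 _ _
    ; H<A'  = affine-≤ 11 15 12 16 _ _
    }

  cod : IsPointedBox (IVb (1 + k)) (IIb (1 + k)) (IIt (1 + k)) (IVb (2 + k))
  cod = IsPointedBox-≡ IVb-1+k IIb-1+k IIt-1+k IVb-2+k record
    { 0<A   = s≤s z≤n
    ; A<A'  = affine-≤ 16 31 16 32 _ _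
    ; 1+A<L = affine-≤ 17 21 16 22 _ _
    ; H<A'  = affine-≤ 23 31 24 32 _ _
    }

  2^[1+n] : 2 ^ suc n ≡ 2 + 2 * a
  2^[1+n] = 2^[j+n] 1

  2^[1+n]*c : ∀ c → 2 ^ suc n * c ≡ 2 * c + 2 * c * a
  2^[1+n]*c c = trans (cong (_* c) 2^[1+n]) (solve (a ∷ c ∷ []))

  allOnes[1+n] : allOnes (suc n) ≡ 1 + 2 * a
  allOnes[1+n] = suc-injective (trans (suc-allOnes (suc n)) 2^[1+n])

  x+[1+y]∸1 : ∀ x y → x + suc y ∸ 1 ≡ x + y
  x+[1+y]∸1 x y = cong (_∸ 1) (+-suc x y)

  ShiftDichotomy : ℕ → Set
  ShiftDichotomy v =
    (P₂ v ≡ 7 + 8 * a × P₂ (v + (12 + 12 * a)) ≡ 15 + 16 * a) ⊎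
    ((9 + 10 * a ≤ P₂ v × P₂ v ≤ 10 + 12 * a) × P₂ (v + (12 + 12 * a)) ≡ P₂ v + (12 + 12 * a))

  P₂≡2^[1+n]*c∸1 : ∀ d r t c m → r < 2 ^ suc n → zerosBelow (suc n) r + d ≡ 1 → t < 2 ^ 4 →
    clearBelowZero 4 d t ≡ c → r + 2 ^ suc n * t ≡ m → P₂ m ≡ 2 ^ suc n * c ∸ 1
  P₂≡2^[1+n]*c∸1 d r t c m r<2^[1+n] z+d≡1 t<16 refl refl =
    P₂-secondZeroAbove (suc n) 4 d r t r<2^[1+n] t<16 z+d≡1

  2^[1+n]*4∸1 : 2 ^ suc n * 4 ∸ 1 ≡ 7 + 8 * a
  2^[1+n]*4∸1 = cong (_∸ 1) (2^[1+n]*c 4)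

  2^[1+n]*8∸1 : 2 ^ suc n * 8 ∸ 1 ≡ 15 + 16 * a
  2^[1+n]*8∸1 = cong (_∸ 1) (2^[1+n]*c 8)

  shiftDichotomy-IIIb : ShiftDichotomy (9 + 10 * a)
  shiftDichotomy-IIIb = inj₁
    ( trans (P₂≡2^[1+n]*c∸1 1 ones 4 4 (9 + 10 * a) ones<2^[1+n] zeros≡0 (≤ᵇ⇒≤ 5 16 _) refl
               (trans (cong₂ _+_ allOnes[1+n] (2^[1+n]*c 4)) (solve (a ∷ [])))) 2^[1+n]*4∸1
    , trans (P₂≡2^[1+n]*c∸1 1 ones 10 8 (9 + 10 * a + (12 + 12 * a)) ones<2^[1+n] zeros≡0
               (≤ᵇ⇒≤ 11 16 _) refl
               (trans (cong₂ _+_ allOnes[1+n] (2^[1+n]*c 10)) (solve (a ∷ [])))) 2^[1+n]*8∸1 )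
    where
    ones : ℕ
    ones = allOnes (suc n)
    ones<2^[1+n] : ones < 2 ^ suc n
    ones<2^[1+n] = ≤-reflexive (suc-allOnes (suc n))
    zeros≡0 : zerosBelow (suc n) ones + 1 ≡ 1
    zeros≡0 = cong (_+ 1) (zerosBelow-allOnes (suc n))

  ≤2a⇒<2^[1+n] : ∀ {r} → r ≤ 2 * a → r < 2 ^ suc n
  ≤2a⇒<2^[1+n] {r} r≤2a = subst (r <_) (sym 2^[1+n]) (s≤s (m≤n⇒m≤1+n r≤2a))

  interior≡ : ∀ r → r + (10 + 10 * a) ≡ r + 2 ^ suc n * 5
  interior≡ r = cong (r +_) (sym (2^[1+n]*c 5))

  interior+shift≡ : ∀ r → r + (10 + 10 * a) + (12 + 12 * a) ≡ r + 2 ^ suc n * 11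
  interior+shift≡ r = trans regroup (cong (r +_) (sym (2^[1+n]*c 11)))
    where
    regroup : r + (10 + 10 * a) + (12 + 12 * a) ≡ r + (22 + 22 * a)
    regroup = solve (a ∷ r ∷ [])

  shiftDichotomy-interior : ∀ r → r ≤ 2 * a → ShiftDichotomy (r + (10 + 10 * a))
  shiftDichotomy-interior r r≤2a with zerosBelow (suc n) r in zeros≡
  ... | zero = contradiction (subst (_≤ 2 * a) r≡1+2a r≤2a) 1+n≰n
    where
    r≡1+2a : r ≡ 1 + 2 * a
    r≡1+2a = trans (zerosBelow≡0⇒allOnes (suc n) r (≤2a⇒<2^[1+n] r≤2a) zeros≡) allOnes[1+n]
  ... | suc zero = inj₁
    ( trans (P₂≡2^[1+n]*c∸1 0 r 5 4 (r + (10 + 10 * a)) (≤2a⇒<2^[1+n] r≤2a) oneZero (≤ᵇ⇒≤ 6 16 _) refl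
               (sym (interior≡ r))) 2^[1+n]*4∸1
    , trans (P₂≡2^[1+n]*c∸1 0 r 11 8 (r + (10 + 10 * a) + (12 + 12 * a)) (≤2a⇒<2^[1+n] r≤2a) oneZero
               (≤ᵇ⇒≤ 12 16 _) refl (sym (interior+shift≡ r))) 2^[1+n]*8∸1 )
    where
    oneZero : zerosBelow (suc n) r + 0 ≡ 1
    oneZero = trans (+-identityʳ _) zeros≡
  ... | suc (suc _) with P₂-secondZeroWithin (suc n) r (≤2a⇒<2^[1+n] r≤2a)
                           (subst (1 <_) (sym zeros≡) (s≤s (s≤s z≤n)))
  ...   | x , x≤r , P₂[r+2^p*t] = inj₂
    ( (subst (9 + 10 * a ≤_) (sym P₂v≡) (m≤n+m _ x) , subst (_≤ 10 + 12 * a) (sym P₂v≡) x+L≤H)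
    , (begin
      P₂ (r + (10 + 10 * a) + (12 + 12 * a))  ≡⟨ cong P₂ (interior+shift≡ r) ⟩
      P₂ (r + 2 ^ suc n * 11)                 ≡⟨ P₂[r+2^p*t] 11 ⟩
      x + 2 ^ suc n * 11 ∸ 1                  ≡⟨ cong (λ y → x + y ∸ 1) (2^[1+n]*c 11) ⟩
      x + (22 + 22 * a) ∸ 1                   ≡⟨ x+[1+y]∸1 x _ ⟩
      x + (21 + 22 * a)                       ≡⟨ solve (a ∷ x ∷ []) ⟩
      x + (9 + 10 * a) + (12 + 12 * a)        ≡⟨ cong (_+ (12 + 12 * a)) P₂v≡ ⟨
      P₂ (r + (10 + 10 * a)) + (12 + 12 * a)  ∎) )
    where
    open ≡-Reasoning
    P₂v≡ : P₂ (r + (10 + 10 * a)) ≡ x + (9 + 10 * a)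
    P₂v≡ = trans (cong P₂ (interior≡ r)) (trans (P₂[r+2^p*t] 5)
             (trans (cong (λ y → x + y ∸ 1) (2^[1+n]*c 5)) (x+[1+y]∸1 x _)))
    2a+L≡ : 2 * a + (9 + 10 * a) ≡ 9 + 12 * a
    2a+L≡ = solve (a ∷ [])
    x+L≤H : x + (9 + 10 * a) ≤ 10 + 12 * a
    x+L≤H = ≤-trans (+-monoˡ-≤ (9 + 10 * a) (≤-trans x≤r r≤2a))
                    (≤-trans (≤-reflexive 2a+L≡) (n≤1+n (9 + 12 * a)))

  shiftDichotomy : ∀ {v} → 9 + 10 * a ≤ v → v ≤ 10 + 12 * a → ShiftDichotomy v
  shiftDichotomy {v} L≤v v≤H with m≤n⇒m<n∨m≡n L≤v
  ... | inj₂ refl = shiftDichotomy-IIIb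
  ... | inj₁ L<v  = subst ShiftDichotomy (m∸n+n≡m L<v)
    (shiftDichotomy-interior (v ∸ (10 + 10 * a)) (m≤n+o⇒m∸n≤o v (10 + 10 * a) v≤[10+10a]+2a))
    where
    H≡ : 10 + 12 * a ≡ 10 + 10 * a + 2 * a
    H≡ = solve (a ∷ [])
    v≤[10+10a]+2a : v ≤ 10 + 10 * a + 2 * a
    v≤[10+10a]+2a = subst (v ≤_) H≡ v≤H

  intervalShift : IntervalShift (IVb k) (IVb (1 + k)) (IVb (2 + k)) (IIIb k) (IIt k)
                                (IIb (1 + k)) (IIt (1 + k)) (3 * 2 ^ (k ∸ 2)) (ψ k) P₂
  intervalShift = record
    { dom     = dom
    ; cod     = cod
    ; L'≡L+s  = L'≡L+s
    ; H'≡H+s  = H'≡H+s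
    ; f-0     = refl
    ; f-A     = f-A
    ; f-shift = f-shift
    ; P-A     = P₂[2^p∸1]≡0 (3 + n)
    ; P-A'    = P₂[2^p∸1]≡0 (4 + n)
    ; P-shift = P-shift
    }
    where
    module Dom = IsPointedBox dom
    s : ℕ
    s = 3 * 2 ^ (k ∸ 2)

    L'≡L+s : IIb (1 + k) ≡ IIIb k + s
    L'≡L+s = trans IIb-1+k (trans L'≡ (sym (cong₂ _+_ IIIb-k shift≡)))
      where
      L'≡ : 21 + 22 * a ≡ 9 + 10 * a + (12 + 12 * a)
      L'≡ = solve (a ∷ [])

    H'≡H+s : IIt (1 + k) ≡ IIt k + s
    H'≡H+s = trans IIt-1+k (trans H'≡ (sym (cong₂ _+_ IIt-k shift≡)))
      where
      H'≡ : 22 + 24 * a ≡ 10 + 12 * a + (12 + 12 * a)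
      H'≡ = solve (a ∷ [])

    f-A : ψ k (IVb k) ≡ IVb (1 + k)
    f-A = ψ-IVb k (≢-sym (<⇒≢ Dom.0<A))

    f-shift : ∀ {x} → IIIb k ≤ x → x ≤ IIt k → ψ k x ≡ x + s
    f-shift L≤x _ = ψ-shift k _ (Dom.L≤⇒≢0 L≤x) (Dom.L≤⇒≢A L≤x)

    P-shift : ∀ {v} → IIIb k ≤ v → v ≤ IIt k →
      Pointed (IVb k) (IIIb k) (IIt k) (P₂ v) × P₂ (v + s) ≡ ψ k (P₂ v)
    P-shift {v} L≤v v≤H =
      fromDichotomy (shiftDichotomy (subst (_≤ v) IIIb-k L≤v) (subst (v ≤_) IIt-k v≤H))
      where
      open ≡-Reasoning
      P₂[v+s] : P₂ (v + s) ≡ P₂ (v + (12 + 12 * a))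
      P₂[v+s] = cong (λ y → P₂ (v + y)) shift≡
      fromDichotomy : ShiftDichotomy v →
        Pointed (IVb k) (IIIb k) (IIt k) (P₂ v) × P₂ (v + s) ≡ ψ k (P₂ v)
      fromDichotomy (inj₁ (P₂v≡ , P₂[v+s]≡)) = inj₂ (inj₁ P₂v≡IVb) , (begin
        P₂ (v + s)         ≡⟨ trans P₂[v+s] P₂[v+s]≡ ⟩
        15 + 16 * a        ≡⟨ IVb-1+k ⟨
        IVb (1 + k)        ≡⟨ f-A ⟨
        ψ k (IVb k)        ≡⟨ cong (ψ k) P₂v≡IVb ⟨
        ψ k (P₂ v)         ∎)
        where
        P₂v≡IVb : P₂ v ≡ IVb k
        P₂v≡IVb = trans P₂v≡ (sym IVb-k)
      fromDichotomy (inj₂ ((L≤P₂v , P₂v≤H) , P₂[v+s]≡)) = inj₂ (inj₂ (L≤P₂v' , P₂v≤H')) , (begin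
        P₂ (v + s)              ≡⟨ trans P₂[v+s] P₂[v+s]≡ ⟩
        P₂ v + (12 + 12 * a)    ≡⟨ cong (P₂ v +_) shift≡ ⟨
        P₂ v + s                ≡⟨ f-shift L≤P₂v' P₂v≤H' ⟨
        ψ k (P₂ v)              ∎)
        where
        L≤P₂v' : IIIb k ≤ P₂ v
        L≤P₂v' = subst (_≤ P₂ v) (sym IIIb-k) L≤P₂v
        P₂v≤H' : P₂ v ≤ IIt k
        P₂v≤H' = subst (P₂ v ≤_) (sym IIt-k) P₂v≤H

mainTheorem13 : (k : ℕ) → 4 ≤ k →
    ((∀ v → Dom k v → Node k v) × (∀ v → Cod k v → Node (suc k) v)) ×
    IsColourIso (Dom k) (Blue k) (Red k) (Cod k) (Blue (suc k)) (Red (suc k)) (ψ k)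
mainTheorem13 (suc (suc (suc (suc n)))) (s≤s (s≤s (s≤s (s≤s _)))) =
  ((λ _ → IsPointedBox.pointed⇒node dom) , (λ _ → IsPointedBox.pointed⇒node cod)) , isColourIso
  where
  open IntervalShift (Boxes.intervalShift n (pred (2 ^ n)) (sym (suc-pred (2 ^ n) {{m^n≢0 2 n}})))
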